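{- Let $A\in\mathbb{Z}^{m\times d}$ with $\ker_{\mathbb{Z}}(A)\cap\mathbb{N}^d=\{0\}$ and let $\mathcal{M}$ be a Markov basis for $\mathcal{P}_A$. Then there exists a constant $C\in\mathbb{N}$ such that $\operatorname{diam}(\mathcal{F}^c(\mathcal{M}))\le C$ for all $\mathcal{F}\in\mathcal{P}_A$.
   Context: $\mathbb{N}=\{0,1,2,\dots\}$. For $A\in\mathbb{Z}^{m\times d}$ and $b\in\mathbb{Z}^m$, the $b$-fiber of $A$ is $\mathcal{F}_{A,b}:=\{u\in\mathbb{N}^d: Au=b\}$, and $\mathcal{P}_A:=\{\mathcal{F}_{A,b}: b\in\mathbb{N}A\}$, where $\mathbb{N}A$ is the semigroup generated by the columns of $A$. For finite sets $\mathcal{F},\mathcal{M}\subset\mathbb{Z}^d$, $\mathcal{F}(\mathcal{M})$ is the graph on node set $\mathcal{F}$ in which $u,v$ are adjacent if $u-v\in\mathcal{M}$ or $v-u\in\mathcal{M}$. The compression of $\mathcal{F}(\mathcal{M})$ is the graph $\mathcal{F}^c(\mathcal{M}):=\mathcal{F}(\mathbb{Z}\cdot\mathcal{M})$, where $\mathbb{Z}\cdot\mathcal{M}:=\{\lambda m:\lambda\in\mathbb{Z},m\in\mathcal{M}\}$. A finite set $\mathcal{M}\subset\mathbb{Z}^d$ is a Markov basis of a collection $\mathcal{P}$ of finite subsets of $\mathbb{Z}^d$ if $\mathcal{F}(\mathcal{M})$ is connected for every $\mathcal{F}\in\mathcal{P}$. The diameter $\operatorname{diam}$ of a graph is the maximum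 graph distance between two of its nodes (infinite if disconnected). -}

module Defs where

open import Data.Nat using (ℕ; zero; suc; _≤_)
open import Data.Integer using (ℤ; +_; _+_; _-_; _*_)
open import Data.Vec using (Vec; map; zipWith; foldr; replicate)
open import Data.List using (List)
open import Data.List.Membership.Propositional using (_∈_)
open import Data.Product using (Σ; ∃; ∃-syntax; _×_; _,_)
open import Data.Sum using (_⊎_)
open import Relation.Binary.PropositionalEquality using (_≡_)

Matrix : ℕ → ℕ → Set
Matrix m d = Vec (Vec ℤ d) m

ι : ∀ {d} → Vec ℕ d → Vec ℤ d
ι = map (λ n → + n)

dot : ∀ {d} → Vec ℤ d → Vec ℤ d → ℤ
dot x y = foldr _ _+_ (+ 0) (zipWith _*_ x y)

_·_ : ∀ {m d} → Matrix m d → Vec ℤ d → Vec ℤ m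
A · x = map (λ row → dot row x) A

diff : ∀ {d} → Vec ℕ d → Vec ℕ d → Vec ℤ d
diff u v = zipWith _-_ (ι u) (ι v)

scale : ∀ {d} → ℤ → Vec ℤ d → Vec ℤ d
scale l x = map (l *_) x

KerPositiveTrivial : ∀ {m d} → Matrix m d → Set
KerPositiveTrivial {m} {d} A =
  (u : Vec ℕ d) → A · ι u ≡ replicate m (+ 0) → u ≡ replicate d 0

InSemigroup : ∀ {m d} → Matrix m d → Vec ℤ m → Set
InSemigroup {m} {d} A b = ∃[ v ] (A · ι {d} v ≡ b)

InFiber : ∀ {m d} → Matrix m d → Vec ℤ m → Vec ℕ d → Set
InFiber A b u = A · ι u ≡ b

Adj : ∀ {d} → List (Vec ℤ d) → Vec ℕ d → Vec ℕ d → Set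
Adj M u v = (diff u v ∈ M) ⊎ (diff v u ∈ M)

InZM : ∀ {d} → List (Vec ℤ d) → Vec ℤ d → Set
InZM M x = ∃[ l ] ∃[ y ] (y ∈ M × x ≡ scale l y)

-- Adjacency in the compression F^c(M) = F(ℤ·M).
AdjC : ∀ {d} → List (Vec ℤ d) → Vec ℕ d → Vec ℕ d → Set
AdjC M u v = InZM M (diff u v) ⊎ InZM M (diff v u)

data Walk {d : ℕ} (F : Vec ℕ d → Set) (R : Vec ℕ d → Vec ℕ d → Set)
          : ℕ → Vec ℕ d → Vec ℕ d → Set where
  here  : ∀ {u} → F u → Walk F R zero u u
  step  : ∀ {n u w v} → F u → R u w → Walk F R n w v → Walk F R (suc n) u v

Connected : ∀ {d} → (Vec ℕ d → Set) → (Vec ℕ d → Vec ℕ d → Set) → Set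
Connected {d} F R = (u v : Vec ℕ d) → F u → F v → ∃[ n ] Walk F R n u v

DiamLe : ∀ {d} → (Vec ℕ d → Set) → (Vec ℕ d → Vec ℕ d → Set) → ℕ → Set
DiamLe {d} F R C = (u v : Vec ℕ d) → F u → F v → ∃[ n ] (n ≤ C × Walk F R n u v)

MarkovBasis : ∀ {m d} → Matrix m d → List (Vec ℤ d) → Set
MarkovBasis {m} A M = (b : Vec ℤ m) → InSemigroup A b → Connected (InFiber A b) (Adj M)

-- The pairs (u, v) with Au = Av are the ℕ-solutions of the homogeneous system [A | -A], so by
-- Gordan's lemma they are the ℕ-combinations Σ kᵢ (sᵢ, tᵢ) of finitely many such pairs. As M is a
-- Markov basis, each sᵢ is joined to tᵢ by a walk of some length nᵢ in F(M). Starting from u and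
-- replacing kᵢ sᵢ by kᵢ tᵢ one i at a time along the walk of (sᵢ, tᵢ) scaled by kᵢ reaches v; every
-- step moves by kᵢ times an element of M, so this is a walk of length Σ nᵢ in the compression,
-- a bound independent of the fibre.
--
-- Gordan's lemma is proved one equation at a time. A solution of c·k = 0 either has all entries
-- below a bound depending only on c, or contains a smaller nonzero solution that can be split off:
-- a unit vector eₗ with cₗ = 0, or (-cⱼ) eᵢ + cᵢ eⱼ with cᵢ > 0 > cⱼ; so the solutions with bounded
-- entries generate.

module Submission where

open import Defs
open import Algebra.Bundles using (CommutativeSemigroup)
import Algebra.Properties.CommutativeSemigroup as CommutativeSemigroupProperties
open import Level using (0ℓ)
open import Data.Nat as ℕ using (ℕ; zero; suc; _≤_; _<_; z≤n; s≤s)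
import Data.Nat.Properties as ℕP
open import Data.Nat.Induction using (<-wellFounded)
open import Data.Integer as ℤ using (ℤ; +_; -[1+_]; 0ℤ)
import Data.Integer.Properties as ℤP
open import Data.Integer.Tactic.RingSolver using (solve-∀)
open import Data.Fin as Fin using (Fin)
import Data.Fin.Properties as FinP
open import Data.Vec as V using (Vec; []; _∷_; lookup)
import Data.Vec.Properties as VP
open import Data.Vec.Membership.Propositional using (_∈_)
open import Data.Vec.Membership.Propositional.Properties using (∈-fromList⁺)
open import Data.Vec.Relation.Unary.Any using (here; there)
open import Data.Vec.Relation.Unary.All as All using (All)
import Data.Vec.Relation.Unary.All.Properties as AllP
open import Data.List as L using (List)
open import Data.List.Membership.Propositional using () renaming (_∈_ to _∈ₗ_)
open import Data.List.Membership.Propositional.Properties using (∈-cartesianProductWith⁺; ∈-upTo⁺; ∈-filter⁺)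
import Data.List.Relation.Unary.All as ListAll
open import Data.List.Relation.Unary.All.Properties using (all-filter)
import Data.List.Relation.Unary.Any as ListAny
open import Data.Product using (∃-syntax; _×_; _,_)
open import Data.Sum using (_⊎_; inj₁; inj₂)
open import Induction.WellFounded using (Acc; acc)
open import Relation.Nullary using (yes; no)
open import Relation.Nullary.Decidable using (_×-dec_)
open import Relation.Binary.PropositionalEquality
open import Relation.Binary.PropositionalEquality.Algebra using (isMagma)

infixl 6 _+ᵥ_
infixl 7 _*ᵥ_

_+ᵥ_ : ∀ {n} → Vec ℕ n → Vec ℕ n → Vec ℕ n
_+ᵥ_ = V.zipWith ℕ._+_

_*ᵥ_ : ∀ {n} → ℕ → Vec ℕ n → Vec ℕ n
k *ᵥ x = V.map (k ℕ.*_) x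

0ᵥ : ∀ {n} → Vec ℕ n
0ᵥ = V.replicate _ 0

+ᵥ-assoc : ∀ {n} (x y z : Vec ℕ n) → (x +ᵥ y) +ᵥ z ≡ x +ᵥ (y +ᵥ z)
+ᵥ-assoc = VP.zipWith-assoc ℕP.+-assoc

+ᵥ-comm : ∀ {n} (x y : Vec ℕ n) → x +ᵥ y ≡ y +ᵥ x
+ᵥ-comm = VP.zipWith-comm ℕP.+-comm

+ᵥ-identityˡ : ∀ {n} (x : Vec ℕ n) → 0ᵥ +ᵥ x ≡ x
+ᵥ-identityˡ = VP.zipWith-identityˡ ℕP.+-identityˡ

+ᵥ-identityʳ : ∀ {n} (x : Vec ℕ n) → x +ᵥ 0ᵥ ≡ x
+ᵥ-identityʳ = VP.zipWith-identityʳ ℕP.+-identityʳ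

+ᵥ-commutativeSemigroup : ℕ → CommutativeSemigroup 0ℓ 0ℓ
+ᵥ-commutativeSemigroup n = record
  { isCommutativeSemigroup = record
    { isSemigroup = record { isMagma = isMagma (_+ᵥ_ {n}) ; assoc = +ᵥ-assoc }
    ; comm = +ᵥ-comm
    }
  }

module +ᵥ {n} = CommutativeSemigroupProperties (+ᵥ-commutativeSemigroup n)

*ᵥ-distribˡ-+ᵥ : ∀ {n} k (x y : Vec ℕ n) → k *ᵥ (x +ᵥ y) ≡ k *ᵥ x +ᵥ k *ᵥ y
*ᵥ-distribˡ-+ᵥ k [] [] = refl
*ᵥ-distribˡ-+ᵥ k (x ∷ xs) (y ∷ ys) = cong₂ _∷_ (ℕP.*-distribˡ-+ k x y) (*ᵥ-distribˡ-+ᵥ k xs ys)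

*ᵥ-distribʳ-+ : ∀ {n} k l (x : Vec ℕ n) → (k ℕ.+ l) *ᵥ x ≡ k *ᵥ x +ᵥ l *ᵥ x
*ᵥ-distribʳ-+ k l [] = refl
*ᵥ-distribʳ-+ k l (x ∷ xs) = cong₂ _∷_ (ℕP.*-distribʳ-+ x k l) (*ᵥ-distribʳ-+ k l xs)

*ᵥ-assoc : ∀ {n} k l (x : Vec ℕ n) → k *ᵥ (l *ᵥ x) ≡ (k ℕ.* l) *ᵥ x
*ᵥ-assoc k l x = trans (sym (VP.map-∘ (k ℕ.*_) (l ℕ.*_) x)) (VP.map-cong (λ y → sym (ℕP.*-assoc k l y)) x)

*ᵥ-zeroʳ : ∀ {n} k → k *ᵥ 0ᵥ {n} ≡ 0ᵥ
*ᵥ-zeroʳ {n} k = trans (VP.map-replicate (k ℕ.*_) 0 n) (cong (V.replicate n) (ℕP.*-zeroʳ k))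

*ᵥ-zeroˡ : ∀ {n} (x : Vec ℕ n) → 0 *ᵥ x ≡ 0ᵥ
*ᵥ-zeroˡ x = VP.map-const x 0

*ᵥ-identityˡ : ∀ {n} (x : Vec ℕ n) → 1 *ᵥ x ≡ x
*ᵥ-identityˡ x = trans (VP.map-cong ℕP.*-identityˡ x) (VP.map-id x)

lookup-+ᵥ : ∀ {n} (x y : Vec ℕ n) i → lookup (x +ᵥ y) i ≡ lookup x i ℕ.+ lookup y i
lookup-+ᵥ x y i = VP.lookup-zipWith ℕ._+_ i x y

sum-+ᵥ : ∀ {n} (x y : Vec ℕ n) → V.sum (x +ᵥ y) ≡ V.sum x ℕ.+ V.sum y
sum-+ᵥ [] [] = refl
sum-+ᵥ (x ∷ xs) (y ∷ ys) = trans (cong (x ℕ.+ y ℕ.+_) (sum-+ᵥ xs ys)) (ℕ+.interchange x y (V.sum xs) (V.sum ys))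
  where module ℕ+ = CommutativeSemigroupProperties ℕP.+-commutativeSemigroup

lincomb : ∀ {n t} → Vec ℕ t → Vec (Vec ℕ n) t → Vec ℕ n
lincomb [] [] = 0ᵥ
lincomb (k ∷ ks) (g ∷ G) = k *ᵥ g +ᵥ lincomb ks G

lincomb-0 : ∀ {n t} (G : Vec (Vec ℕ n) t) → lincomb 0ᵥ G ≡ 0ᵥ
lincomb-0 [] = refl
lincomb-0 (g ∷ G) = trans (cong₂ _+ᵥ_ (*ᵥ-zeroˡ g) (lincomb-0 G)) (+ᵥ-identityˡ 0ᵥ)

lincomb-+ : ∀ {n t} (ks ls : Vec ℕ t) (G : Vec (Vec ℕ n) t) →
  lincomb (ks +ᵥ ls) G ≡ lincomb ks G +ᵥ lincomb ls G
lincomb-+ [] [] [] = sym (+ᵥ-identityˡ 0ᵥ)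
lincomb-+ (k ∷ ks) (l ∷ ls) (g ∷ G) = begin
  (k ℕ.+ l) *ᵥ g +ᵥ lincomb (ks +ᵥ ls) G
    ≡⟨ cong₂ _+ᵥ_ (*ᵥ-distribʳ-+ k l g) (lincomb-+ ks ls G) ⟩
  (k *ᵥ g +ᵥ l *ᵥ g) +ᵥ (lincomb ks G +ᵥ lincomb ls G)
    ≡⟨ +ᵥ.interchange (k *ᵥ g) (l *ᵥ g) (lincomb ks G) (lincomb ls G) ⟩
  (k *ᵥ g +ᵥ lincomb ks G) +ᵥ (l *ᵥ g +ᵥ lincomb ls G) ∎
  where open ≡-Reasoning

lincomb-* : ∀ {n t} k (ks : Vec ℕ t) (G : Vec (Vec ℕ n) t) → lincomb (k *ᵥ ks) G ≡ k *ᵥ lincomb ks G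
lincomb-* k [] [] = sym (*ᵥ-zeroʳ k)
lincomb-* k (l ∷ ks) (g ∷ G) = begin
  (k ℕ.* l) *ᵥ g +ᵥ lincomb (k *ᵥ ks) G ≡⟨ cong₂ _+ᵥ_ (sym (*ᵥ-assoc k l g)) (lincomb-* k ks G) ⟩
  k *ᵥ (l *ᵥ g) +ᵥ k *ᵥ lincomb ks G   ≡⟨ sym (*ᵥ-distribˡ-+ᵥ k (l *ᵥ g) (lincomb ks G)) ⟩
  k *ᵥ (l *ᵥ g +ᵥ lincomb ks G)         ∎
  where open ≡-Reasoning

lincomb-lincomb : ∀ {n t s} (ks : Vec ℕ s) (H : Vec (Vec ℕ t) s) (G : Vec (Vec ℕ n) t) →
  lincomb (lincomb ks H) G ≡ lincomb ks (V.map (λ h → lincomb h G) H)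
lincomb-lincomb [] [] G = lincomb-0 G
lincomb-lincomb (k ∷ ks) (h ∷ H) G = begin
  lincomb (k *ᵥ h +ᵥ lincomb ks H) G
    ≡⟨ lincomb-+ (k *ᵥ h) (lincomb ks H) G ⟩
  lincomb (k *ᵥ h) G +ᵥ lincomb (lincomb ks H) G
    ≡⟨ cong₂ _+ᵥ_ (lincomb-* k h G) (lincomb-lincomb ks H G) ⟩
  k *ᵥ lincomb h G +ᵥ lincomb ks (V.map (λ h → lincomb h G) H) ∎
  where open ≡-Reasoning

infix 4 _∈⟨_⟩

_∈⟨_⟩ : ∀ {n t} → Vec ℕ n → Vec (Vec ℕ n) t → Set
x ∈⟨ G ⟩ = ∃[ ks ] x ≡ lincomb ks G

0ᵥ∈⟨⟩ : ∀ {n t} (G : Vec (Vec ℕ n) t) → 0ᵥ ∈⟨ G ⟩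
0ᵥ∈⟨⟩ G = 0ᵥ , sym (lincomb-0 G)

∈⟨⟩-+generator : ∀ {n t} {g x : Vec ℕ n} {G : Vec (Vec ℕ n) t} → g ∈ G → x ∈⟨ G ⟩ → g +ᵥ x ∈⟨ G ⟩
∈⟨⟩-+generator {g = g} {G = .g ∷ G} (here refl) (k ∷ ks , refl) = suc k ∷ ks , (begin
  g +ᵥ (k *ᵥ g +ᵥ lincomb ks G)   ≡⟨ sym (+ᵥ-assoc g (k *ᵥ g) (lincomb ks G)) ⟩
  (g +ᵥ k *ᵥ g) +ᵥ lincomb ks G   ≡⟨ cong (λ y → y +ᵥ k *ᵥ g +ᵥ lincomb ks G) (sym (*ᵥ-identityˡ g)) ⟩
  (1 *ᵥ g +ᵥ k *ᵥ g) +ᵥ lincomb ks G ≡⟨ cong (_+ᵥ lincomb ks G) (sym (*ᵥ-distribʳ-+ 1 k g)) ⟩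
  suc k *ᵥ g +ᵥ lincomb ks G      ∎)
  where open ≡-Reasoning
∈⟨⟩-+generator {g = g} {G = h ∷ G} (there g∈G) (k ∷ ks , refl) with ∈⟨⟩-+generator g∈G (ks , refl)
... | ks′ , eq = k ∷ ks′ , (begin
  g +ᵥ (k *ᵥ h +ᵥ lincomb ks G)   ≡⟨ +ᵥ.x∙yz≈y∙xz g (k *ᵥ h) (lincomb ks G) ⟩
  k *ᵥ h +ᵥ (g +ᵥ lincomb ks G)   ≡⟨ cong (k *ᵥ h +ᵥ_) eq ⟩
  k *ᵥ h +ᵥ lincomb ks′ G         ∎)
  where open ≡-Reasoning

∈⟨⟩-generator : ∀ {n t} {g : Vec ℕ n} {G : Vec (Vec ℕ n) t} → g ∈ G → g ∈⟨ G ⟩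
∈⟨⟩-generator {g = g} {G} g∈G with ∈⟨⟩-+generator g∈G (0ᵥ∈⟨⟩ G)
... | ks , eq = ks , trans (sym (+ᵥ-identityʳ g)) eq

record FinitelyGenerated {n} (P : Vec ℕ n → Set) : Set where
  field
    size       : ℕ
    generators : Vec (Vec ℕ n) size
    sound      : All P generators
    complete   : ∀ {x} → P x → x ∈⟨ generators ⟩

lin : ∀ {n} → Vec ℤ n → Vec ℕ n → ℤ
lin a x = dot a (ι x)

lin-+ᵥ : ∀ {n} (a : Vec ℤ n) (x y : Vec ℕ n) → lin a (x +ᵥ y) ≡ lin a x ℤ.+ lin a y
lin-+ᵥ [] [] [] = refl
lin-+ᵥ (a ∷ as) (x ∷ xs) (y ∷ ys) = begin
  a ℤ.* + (x ℕ.+ y) ℤ.+ lin as (xs +ᵥ ys)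
    ≡⟨ cong₂ (λ u v → a ℤ.* u ℤ.+ v) (ℤP.pos-+ x y) (lin-+ᵥ as xs ys) ⟩
  a ℤ.* (+ x ℤ.+ + y) ℤ.+ (lin as xs ℤ.+ lin as ys)
    ≡⟨ distribute a (+ x) (+ y) (lin as xs) (lin as ys) ⟩
  (a ℤ.* + x ℤ.+ lin as xs) ℤ.+ (a ℤ.* + y ℤ.+ lin as ys) ∎
  where
  open ≡-Reasoning
  distribute : ∀ a x y u v → a ℤ.* (x ℤ.+ y) ℤ.+ (u ℤ.+ v) ≡ (a ℤ.* x ℤ.+ u) ℤ.+ (a ℤ.* y ℤ.+ v)
  distribute = solve-∀

lin-*ᵥ : ∀ {n} (a : Vec ℤ n) k (x : Vec ℕ n) → lin a (k *ᵥ x) ≡ + k ℤ.* lin a x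
lin-*ᵥ [] k [] = sym (ℤP.*-zeroʳ (+ k))
lin-*ᵥ (a ∷ as) k (x ∷ xs) = begin
  a ℤ.* + (k ℕ.* x) ℤ.+ lin as (k *ᵥ xs)
    ≡⟨ cong₂ (λ u v → a ℤ.* u ℤ.+ v) (ℤP.pos-* k x) (lin-*ᵥ as k xs) ⟩
  a ℤ.* (+ k ℤ.* + x) ℤ.+ + k ℤ.* lin as xs
    ≡⟨ factor a (+ k) (+ x) (lin as xs) ⟩
  + k ℤ.* (a ℤ.* + x ℤ.+ lin as xs) ∎
  where
  open ≡-Reasoning
  factor : ∀ a k x u → a ℤ.* (k ℤ.* x) ℤ.+ k ℤ.* u ≡ k ℤ.* (a ℤ.* x ℤ.+ u)
  factor = solve-∀

lin-0ᵥ : ∀ {n} (a : Vec ℤ n) → lin a 0ᵥ ≡ 0ℤ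
lin-0ᵥ [] = refl
lin-0ᵥ (a ∷ as) = cong₂ ℤ._+_ (ℤP.*-zeroʳ a) (lin-0ᵥ as)

lin-zeroˡ : ∀ {n} (x : Vec ℕ n) → lin (V.replicate n 0ℤ) x ≡ 0ℤ
lin-zeroˡ [] = refl
lin-zeroˡ (x ∷ xs) = trans (ℤP.+-identityˡ _) (lin-zeroˡ xs)

lin-lincomb : ∀ {n t} (a : Vec ℤ n) (ks : Vec ℕ t) (G : Vec (Vec ℕ n) t) →
  lin a (lincomb ks G) ≡ lin (V.map (lin a) G) ks
lin-lincomb a [] [] = lin-0ᵥ a
lin-lincomb a (k ∷ ks) (g ∷ G) = begin
  lin a (k *ᵥ g +ᵥ lincomb ks G)                 ≡⟨ lin-+ᵥ a (k *ᵥ g) (lincomb ks G) ⟩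
  lin a (k *ᵥ g) ℤ.+ lin a (lincomb ks G)        ≡⟨ cong₂ ℤ._+_ (lin-*ᵥ a k g) (lin-lincomb a ks G) ⟩
  + k ℤ.* lin a g ℤ.+ lin (V.map (lin a) G) ks   ≡⟨ cong (ℤ._+ _) (ℤP.*-comm (+ k) (lin a g)) ⟩
  lin a g ℤ.* + k ℤ.+ lin (V.map (lin a) G) ks   ∎
  where open ≡-Reasoning

-- A single homogeneous equation

[_↦_] : ∀ {t} → Fin t → ℕ → Vec ℕ t
[ Fin.zero  ↦ a ] = a ∷ 0ᵥ
[ Fin.suc i ↦ a ] = 0 ∷ [ i ↦ a ]

lookup-↦ : ∀ {t} (i : Fin t) a → lookup [ i ↦ a ] i ≡ a
lookup-↦ Fin.zero    a = refl
lookup-↦ (Fin.suc i) a = lookup-↦ i a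

lookup-↦-≤ : ∀ {t} (i l : Fin t) a → lookup [ i ↦ a ] l ≤ a
lookup-↦-≤ Fin.zero    Fin.zero    a = ℕP.≤-refl
lookup-↦-≤ Fin.zero    (Fin.suc l) a = ℕP.≤-trans (ℕP.≤-reflexive (VP.lookup-replicate l 0)) z≤n
lookup-↦-≤ (Fin.suc i) Fin.zero    a = z≤n
lookup-↦-≤ (Fin.suc i) (Fin.suc l) a = lookup-↦-≤ i l a

lin-↦ : ∀ {t} (c : Vec ℤ t) i a → lin c [ i ↦ a ] ≡ lookup c i ℤ.* + a
lin-↦ (c ∷ cs) Fin.zero    a = trans (cong (λ u → c ℤ.* + a ℤ.+ u) (lin-0ᵥ cs)) (ℤP.+-identityʳ _)
lin-↦ (c ∷ cs) (Fin.suc i) a = trans (cong₂ ℤ._+_ (ℤP.*-zeroʳ c) (lin-↦ cs i a)) (ℤP.+-identityˡ _)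

split-↦ : ∀ {t} (k : Vec ℕ t) i {a} → a ≤ lookup k i → k ≡ [ i ↦ a ] +ᵥ V.updateAt k i (ℕ._∸ a)
split-↦ (x ∷ xs) Fin.zero    a≤x = cong₂ _∷_ (sym (ℕP.m+[n∸m]≡n a≤x)) (sym (+ᵥ-identityˡ xs))
split-↦ (x ∷ xs) (Fin.suc i) a≤x = cong (x ∷_) (split-↦ xs i a≤x)

lookup≤sum : ∀ {t} (x : Vec ℕ t) i → lookup x i ≤ V.sum x
lookup≤sum (x ∷ xs) Fin.zero    = ℕP.m≤m+n x (V.sum xs)
lookup≤sum (x ∷ xs) (Fin.suc i) = ℕP.≤-trans (lookup≤sum xs i) (ℕP.m≤n+m (V.sum xs) x)

Bounded : ∀ {t} → ℕ → Vec ℕ t → Set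
Bounded B x = ∀ i → lookup x i ≤ B

box : (t B : ℕ) → List (Vec ℕ t)
box zero    B = L.[ [] ]
box (suc t) B = L.cartesianProductWith _∷_ (L.upTo (suc B)) (box t B)

∈-box : ∀ {t B} {x : Vec ℕ t} → Bounded B x → x ∈ₗ box t B
∈-box {x = []}     x≤B = ListAny.here refl
∈-box {x = x ∷ xs} x≤B =
  ∈-cartesianProductWith⁺ _∷_ (∈-upTo⁺ (s≤s (x≤B Fin.zero))) (∈-box (λ i → x≤B (Fin.suc i)))

pos neg : ℤ → ℕ
pos (+ a)      = a
pos -[1+ _ ]   = 0
neg (+ _)      = 0
neg -[1+ b ]   = suc b

pos≤∣∣ : ∀ z → pos z ≤ ℤ.∣ z ∣
pos≤∣∣ (+ a)    = ℕP.≤-refl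
pos≤∣∣ -[1+ b ] = z≤n

neg≤∣∣ : ∀ z → neg z ≤ ℤ.∣ z ∣
neg≤∣∣ (+ a)    = z≤n
neg≤∣∣ -[1+ b ] = ℕP.≤-refl

pos-neg-trichotomy : ∀ z → 1 ≤ pos z ⊎ 1 ≤ neg z ⊎ z ≡ 0ℤ
pos-neg-trichotomy (+ zero)  = inj₂ (inj₂ refl)
pos-neg-trichotomy (+ suc a) = inj₁ (s≤s z≤n)
pos-neg-trichotomy -[1+ b ]  = inj₂ (inj₁ (s≤s z≤n))

neg-pos-trichotomy : ∀ z → 1 ≤ neg z ⊎ 1 ≤ pos z ⊎ z ≡ 0ℤ
neg-pos-trichotomy z with pos-neg-trichotomy z
... | inj₁ p        = inj₂ (inj₁ p)
... | inj₂ (inj₁ n) = inj₁ n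
... | inj₂ (inj₂ e) = inj₂ (inj₂ e)

weighted : ∀ {t} → (ℤ → ℕ) → Vec ℤ t → Vec ℕ t → ℕ
weighted w []       []       = 0
weighted w (c ∷ cs) (x ∷ xs) = w c ℕ.* x ℕ.+ weighted w cs xs

lin-split : ∀ {t} (c : Vec ℤ t) (k : Vec ℕ t) → lin c k ℤ.+ + weighted neg c k ≡ + weighted pos c k
lin-split []              []       = refl
lin-split (+ a ∷ cs)      (x ∷ xs) = begin
  (+ a ℤ.* + x ℤ.+ lin cs xs) ℤ.+ + N ≡⟨ ℤP.+-assoc (+ a ℤ.* + x) (lin cs xs) (+ N) ⟩
  + a ℤ.* + x ℤ.+ (lin cs xs ℤ.+ + N) ≡⟨ cong₂ ℤ._+_ (sym (ℤP.pos-* a x)) (lin-split cs xs) ⟩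
  + (a ℕ.* x) ℤ.+ + P                 ≡⟨ sym (ℤP.pos-+ (a ℕ.* x) P) ⟩
  + (a ℕ.* x ℕ.+ P)                   ∎
  where
  open ≡-Reasoning
  N = weighted neg cs xs
  P = weighted pos cs xs
lin-split (-[1+ b ] ∷ cs) (x ∷ xs) = begin
  (-[1+ b ] ℤ.* + x ℤ.+ lin cs xs) ℤ.+ + (suc b ℕ.* x ℕ.+ N)
    ≡⟨ cong₂ (λ u v → (u ℤ.+ lin cs xs) ℤ.+ v) negate (ℤP.pos-+ (suc b ℕ.* x) N) ⟩
  (ℤ.- u ℤ.+ lin cs xs) ℤ.+ (u ℤ.+ + N) ≡⟨ cancel u (lin cs xs) (+ N) ⟩
  lin cs xs ℤ.+ + N                     ≡⟨ lin-split cs xs ⟩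
  + weighted pos cs xs                  ∎
  where
  open ≡-Reasoning
  N = weighted neg cs xs
  u = + (suc b ℕ.* x)
  negate : -[1+ b ] ℤ.* + x ≡ ℤ.- u
  negate = trans (sym (ℤP.neg-distribˡ-* (+ suc b) (+ x))) (cong ℤ.-_ (sym (ℤP.pos-* (suc b) x)))
  cancel : ∀ u v w → (ℤ.- u ℤ.+ v) ℤ.+ (u ℤ.+ w) ≡ v ℤ.+ w
  cancel = solve-∀

weighted-balance : ∀ {t} (c : Vec ℤ t) (k : Vec ℕ t) → lin c k ≡ 0ℤ → weighted neg c k ≡ weighted pos c k
weighted-balance c k ck≡0 = ℤP.+-injective (begin
  + weighted neg c k            ≡⟨ sym (ℤP.+-identityˡ _) ⟩
  0ℤ ℤ.+ + weighted neg c k     ≡⟨ cong (ℤ._+ + weighted neg c k) (sym ck≡0) ⟩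
  lin c k ℤ.+ + weighted neg c k ≡⟨ lin-split c k ⟩
  + weighted pos c k            ∎)
  where open ≡-Reasoning

lookup≤weighted : ∀ {t} w (c : Vec ℤ t) (k : Vec ℕ t) i → 1 ≤ w (lookup c i) → lookup k i ≤ weighted w c k
lookup≤weighted w (c ∷ cs) (x ∷ xs) Fin.zero    1≤w =
  ℕP.≤-trans (ℕP.≤-trans (ℕP.≤-reflexive (sym (ℕP.*-identityˡ x))) (ℕP.*-monoˡ-≤ x 1≤w)) (ℕP.m≤m+n (w c ℕ.* x) _)
lookup≤weighted w (c ∷ cs) (x ∷ xs) (Fin.suc i) 1≤w =
  ℕP.≤-trans (lookup≤weighted w cs xs i 1≤w) (ℕP.m≤n+m _ (w c ℕ.* x))

weighted≤ : ∀ {t} w (c : Vec ℤ t) (k : Vec ℕ t) K →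
  (∀ i → w (lookup c i) ≤ K) → (∀ i → 1 ≤ w (lookup c i) → lookup k i < K) →
  weighted w c k ≤ t ℕ.* (K ℕ.* K)
weighted≤ w []       []       K w≤K small = z≤n
weighted≤ w (c ∷ cs) (x ∷ xs) K w≤K small =
  ℕP.+-mono-≤ (term≤ (w≤K Fin.zero) (small Fin.zero))
              (weighted≤ w cs xs K (λ i → w≤K (Fin.suc i)) (λ i → small (Fin.suc i)))
  where
  term≤ : ∀ {v x} → v ≤ K → (1 ≤ v → x < K) → v ℕ.* x ≤ K ℕ.* K
  term≤ {zero}  v≤K x<K = z≤n
  term≤ {suc v} v≤K x<K = ℕP.*-mono-≤ v≤K (ℕP.<⇒≤ (x<K (s≤s z≤n)))

coeffBound : ∀ {t} → Vec ℤ t → ℕ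
coeffBound c = suc (V.sum (V.map ℤ.∣_∣ c))

-- Covers the moves split off below (entries ≤ 2K) and the solutions admitting none (entries ≤ t K²).
entryBound : ∀ {t} → Vec ℤ t → ℕ
entryBound {t} c = t ℕ.* (K ℕ.* K) ℕ.+ (K ℕ.+ K)
  where K = coeffBound c

weight≤coeffBound : ∀ {t} {w : ℤ → ℕ} → (∀ z → w z ≤ ℤ.∣ z ∣) → (c : Vec ℤ t) → ∀ i → w (lookup c i) ≤ coeffBound c
weight≤coeffBound w≤∣∣ c i = ℕP.≤-trans (w≤∣∣ (lookup c i)) (ℕP.≤-trans ∣cᵢ∣≤sum (ℕP.n≤1+n _))
  where
  ∣cᵢ∣≤sum : ℤ.∣ lookup c i ∣ ≤ V.sum (V.map ℤ.∣_∣ c)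
  ∣cᵢ∣≤sum = subst (_≤ _) (VP.lookup-map i ℤ.∣_∣ c) (lookup≤sum (V.map ℤ.∣_∣ c) i)

coeffBound≤entryBound : ∀ {t} (c : Vec ℤ t) → coeffBound c ≤ entryBound c
coeffBound≤entryBound {t} c = ℕP.≤-trans (ℕP.m≤m+n K K) (ℕP.m≤n+m (K ℕ.+ K) (t ℕ.* (K ℕ.* K)))
  where K = coeffBound c

0<sum : ∀ {t} (x : Vec ℕ t) i → 0 < lookup x i → 0 < V.sum x
0<sum x i 0<xᵢ = ℕP.<-≤-trans 0<xᵢ (lookup≤sum x i)

Reducible : ∀ {t} → Vec ℤ t → Vec ℕ t → Set
Reducible c k = ∃[ h ] ∃[ k′ ] (k ≡ h +ᵥ k′ × lin c h ≡ 0ℤ × Bounded (entryBound c) h × 0 < V.sum h)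

zero-coeff-reducible : ∀ {t} (c : Vec ℤ t) (k : Vec ℕ t) l → lookup c l ≡ 0ℤ → 1 ≤ lookup k l → Reducible c k
zero-coeff-reducible c k l cₗ≡0 1≤kₗ =
  [ l ↦ 1 ] , V.updateAt k l (ℕ._∸ 1) , split-↦ k l 1≤kₗ ,
  trans (lin-↦ c l 1) (cong (ℤ._* + 1) cₗ≡0) ,
  (λ i → ℕP.≤-trans (lookup-↦-≤ l i 1) (ℕP.≤-trans (s≤s z≤n) (coeffBound≤entryBound c))) ,
  0<sum [ l ↦ 1 ] l (ℕP.≤-reflexive (sym (lookup-↦ l 1)))

pos-view : ∀ z → 1 ≤ pos z → ∃[ a ] z ≡ + suc a
pos-view (+ suc a) _ = a , refl

neg-view : ∀ z → 1 ≤ neg z → ∃[ b ] z ≡ -[1+ b ]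
neg-view -[1+ b ] _ = b , refl

-- (-cⱼ) eᵢ + cᵢ eⱼ is a solution; it fits under k once both entries reach the coefficient bound.
opposite-coeffs-reducible : ∀ {t} (c : Vec ℤ t) (k : Vec ℕ t) i j →
  1 ≤ pos (lookup c i) → coeffBound c ≤ lookup k i →
  1 ≤ neg (lookup c j) → coeffBound c ≤ lookup k j → Reducible c k
opposite-coeffs-reducible c k i j 1≤cᵢ K≤kᵢ 1≤-cⱼ K≤kⱼ
  with pos-view (lookup c i) 1≤cᵢ | neg-view (lookup c j) 1≤-cⱼ
... | a , cᵢ≡ | b , cⱼ≡ = h , k₂ , k≡h+k₂ , lin-h , bounded-h , 0<sum h i 0<hᵢ
  where
  K = coeffBound c
  h = [ i ↦ suc b ] +ᵥ [ j ↦ suc a ]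
  k₁ = V.updateAt k i (ℕ._∸ suc b)
  k₂ = V.updateAt k₁ j (ℕ._∸ suc a)
  1+b≤K : suc b ≤ K
  1+b≤K = subst (λ z → neg z ≤ K) cⱼ≡ (weight≤coeffBound neg≤∣∣ c j)
  1+a≤K : suc a ≤ K
  1+a≤K = subst (λ z → pos z ≤ K) cᵢ≡ (weight≤coeffBound pos≤∣∣ c i)
  j≢i : j ≢ i
  j≢i refl with () ← trans (sym cᵢ≡) cⱼ≡
  1+a≤k₁ⱼ : suc a ≤ lookup k₁ j
  1+a≤k₁ⱼ = subst (suc a ≤_) (sym (VP.lookup∘updateAt′ j i j≢i k)) (ℕP.≤-trans 1+a≤K K≤kⱼ)
  k≡h+k₂ : k ≡ h +ᵥ k₂
  k≡h+k₂ = begin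
    k                                        ≡⟨ split-↦ k i (ℕP.≤-trans 1+b≤K K≤kᵢ) ⟩
    [ i ↦ suc b ] +ᵥ k₁                      ≡⟨ cong ([ i ↦ suc b ] +ᵥ_) (split-↦ k₁ j 1+a≤k₁ⱼ) ⟩
    [ i ↦ suc b ] +ᵥ ([ j ↦ suc a ] +ᵥ k₂)   ≡⟨ sym (+ᵥ-assoc [ i ↦ suc b ] [ j ↦ suc a ] k₂) ⟩
    h +ᵥ k₂                                  ∎
    where open ≡-Reasoning
  lin-h : lin c h ≡ 0ℤ
  lin-h = begin
    lin c h                                                  ≡⟨ lin-+ᵥ c [ i ↦ suc b ] [ j ↦ suc a ] ⟩
    lin c [ i ↦ suc b ] ℤ.+ lin c [ j ↦ suc a ]              ≡⟨ cong₂ ℤ._+_ (lin-↦ c i (suc b)) (lin-↦ c j (suc a)) ⟩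
    lookup c i ℤ.* + suc b ℤ.+ lookup c j ℤ.* + suc a        ≡⟨ cong₂ (λ u v → u ℤ.* + suc b ℤ.+ v ℤ.* + suc a) cᵢ≡ cⱼ≡ ⟩
    + suc a ℤ.* + suc b ℤ.+ -[1+ b ] ℤ.* + suc a             ≡⟨ cross (+ suc a) (+ suc b) ⟩
    0ℤ                                                       ∎
    where
    open ≡-Reasoning
    cross : ∀ x y → x ℤ.* y ℤ.+ (ℤ.- y) ℤ.* x ≡ 0ℤ
    cross = solve-∀
  bounded-h : Bounded (entryBound c) h
  bounded-h l = begin
    lookup h l                                       ≡⟨ lookup-+ᵥ [ i ↦ suc b ] [ j ↦ suc a ] l ⟩
    lookup [ i ↦ suc b ] l ℕ.+ lookup [ j ↦ suc a ] l ≤⟨ ℕP.+-mono-≤ (lookup-↦-≤ i l (suc b)) (lookup-↦-≤ j l (suc a)) ⟩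
    suc b ℕ.+ suc a                                   ≤⟨ ℕP.+-mono-≤ 1+b≤K 1+a≤K ⟩
    K ℕ.+ K                                           ≤⟨ ℕP.m≤n+m (K ℕ.+ K) _ ⟩
    entryBound c                                      ∎
    where open ℕP.≤-Reasoning
  0<hᵢ : 0 < lookup h i
  0<hᵢ = begin-strict
    0                                                 <⟨ s≤s z≤n ⟩
    suc b                                             ≡⟨ sym (lookup-↦ i (suc b)) ⟩
    lookup [ i ↦ suc b ] i                            ≤⟨ ℕP.m≤m+n _ _ ⟩
    lookup [ i ↦ suc b ] i ℕ.+ lookup [ j ↦ suc a ] i ≡⟨ sym (lookup-+ᵥ [ i ↦ suc b ] [ j ↦ suc a ] i) ⟩
    lookup h i                                        ∎
    where open ℕP.≤-Reasoning

-- If the entries of k at the coefficients of one sign are below the coefficient bound K, that side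
-- has weight ≤ t K², and by balance so has the other side, which bounds its entries.
one-side-small⇒bounded : ∀ {t} (w w′ : ℤ → ℕ) (c : Vec ℤ t) (k : Vec ℕ t) →
  (∀ z → 1 ≤ w z ⊎ 1 ≤ w′ z ⊎ z ≡ 0ℤ) → (∀ z → w z ≤ ℤ.∣ z ∣) →
  weighted w′ c k ≡ weighted w c k →
  (∀ i → 1 ≤ w (lookup c i) → lookup k i < coeffBound c) →
  (∀ i → lookup c i ≡ 0ℤ → lookup k i < 1) →
  Bounded (entryBound c) k
one-side-small⇒bounded {t} w w′ c k trichotomy w≤∣∣ balance small vanishing i with trichotomy (lookup c i)
... | inj₁ 1≤w          = ℕP.≤-trans (ℕP.<⇒≤ (small i 1≤w)) (coeffBound≤entryBound c)
... | inj₂ (inj₂ cᵢ≡0)  = ℕP.≤-trans (ℕP.≤-pred (vanishing i cᵢ≡0)) z≤n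
... | inj₂ (inj₁ 1≤w′) = begin
  lookup k i                ≤⟨ lookup≤weighted w′ c k i 1≤w′ ⟩
  weighted w′ c k           ≡⟨ balance ⟩
  weighted w c k            ≤⟨ weighted≤ w c k K (weight≤coeffBound w≤∣∣ c) small ⟩
  t ℕ.* (K ℕ.* K)           ≤⟨ ℕP.m≤m+n _ (K ℕ.+ K) ⟩
  entryBound c              ∎
  where
  open ℕP.≤-Reasoning
  K = coeffBound c

reducible-or-bounded : ∀ {t} (c : Vec ℤ t) (k : Vec ℕ t) → lin c k ≡ 0ℤ → Reducible c k ⊎ Bounded (entryBound c) k
reducible-or-bounded c k ck≡0 with FinP.any? (λ l → (lookup c l ℤ.≟ 0ℤ) ×-dec (1 ℕ.≤? lookup k l))
... | yes (l , cₗ≡0 , 1≤kₗ) = inj₁ (zero-coeff-reducible c k l cₗ≡0 1≤kₗ)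
... | no noZero
  with FinP.any? (λ i → (1 ℕ.≤? pos (lookup c i)) ×-dec (coeffBound c ℕ.≤? lookup k i))
     | FinP.any? (λ j → (1 ℕ.≤? neg (lookup c j)) ×-dec (coeffBound c ℕ.≤? lookup k j))
... | yes (i , 1≤cᵢ , K≤kᵢ) | yes (j , 1≤-cⱼ , K≤kⱼ) =
  inj₁ (opposite-coeffs-reducible c k i j 1≤cᵢ K≤kᵢ 1≤-cⱼ K≤kⱼ)
... | no noPos | _ = inj₂ (one-side-small⇒bounded pos neg c k pos-neg-trichotomy pos≤∣∣
  (weighted-balance c k ck≡0)
  (λ i 1≤cᵢ → ℕP.≰⇒> (λ K≤kᵢ → noPos (i , 1≤cᵢ , K≤kᵢ)))
  (λ l cₗ≡0 → ℕP.≰⇒> (λ 1≤kₗ → noZero (l , cₗ≡0 , 1≤kₗ))))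
... | yes _ | no noNeg = inj₂ (one-side-small⇒bounded neg pos c k neg-pos-trichotomy neg≤∣∣
  (sym (weighted-balance c k ck≡0))
  (λ j 1≤-cⱼ → ℕP.≰⇒> (λ K≤kⱼ → noNeg (j , 1≤-cⱼ , K≤kⱼ)))
  (λ l cₗ≡0 → ℕP.≰⇒> (λ 1≤kₗ → noZero (l , cₗ≡0 , 1≤kₗ))))

All-fromList : ∀ {n} {P : Vec ℕ n → Set} {xs} → ListAll.All P xs → All P (V.fromList xs)
All-fromList ListAll.[]         = All.[]
All-fromList (px ListAll.∷ pxs) = px All.∷ All-fromList pxs

equation-finitelyGenerated : ∀ {t} (c : Vec ℤ t) → FinitelyGenerated (λ x → lin c x ≡ 0ℤ)
equation-finitelyGenerated {t} c = record
  { size       = L.length smallSolutions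
  ; generators = V.fromList smallSolutions
  ; sound      = All-fromList (all-filter solution? (box t (entryBound c)))
  ; complete   = λ {k} ck≡0 → decompose k (<-wellFounded (V.sum k)) ck≡0
  }
  where
  solution? = λ x → lin c x ℤ.≟ 0ℤ
  smallSolutions = L.filter solution? (box t (entryBound c))
  small∈generators : ∀ {x} → Bounded (entryBound c) x → lin c x ≡ 0ℤ → x ∈ V.fromList smallSolutions
  small∈generators x≤B cx≡0 = ∈-fromList⁺ (∈-filter⁺ solution? (∈-box x≤B) cx≡0)
  decompose : ∀ k → Acc _<_ (V.sum k) → lin c k ≡ 0ℤ → k ∈⟨ V.fromList smallSolutions ⟩
  decompose k (acc smaller) ck≡0 with reducible-or-bounded c k ck≡0
  ... | inj₂ k≤B = ∈⟨⟩-generator (small∈generators k≤B ck≡0)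
  ... | inj₁ (h , k′ , refl , ch≡0 , h≤B , 0<h) =
    ∈⟨⟩-+generator (small∈generators h≤B ch≡0) (decompose k′ (smaller k′<k) ck′≡0)
    where
    k′<k : V.sum k′ < V.sum (h +ᵥ k′)
    k′<k = subst (V.sum k′ <_) (sym (sum-+ᵥ h k′)) (ℕP.m<n+m (V.sum k′) 0<h)
    ck′≡0 : lin c k′ ≡ 0ℤ
    ck′≡0 = begin
      lin c k′                 ≡⟨ ℤP.+-identityˡ (lin c k′) ⟨
      0ℤ ℤ.+ lin c k′          ≡⟨ cong (ℤ._+ lin c k′) ch≡0 ⟨
      lin c h ℤ.+ lin c k′     ≡⟨ lin-+ᵥ c h k′ ⟨
      lin c (h +ᵥ k′)          ≡⟨ ck≡0 ⟩
      0ℤ                       ∎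
      where open ≡-Reasoning

-- Gordan's lemma

Solutions : ∀ {m n} → Vec (Vec ℤ n) m → Vec ℕ n → Set
Solutions A x = All (λ a → lin a x ≡ 0ℤ) A

lin-lincomb-0 : ∀ {n t} (a : Vec ℤ n) (ks : Vec ℕ t) {G : Vec (Vec ℕ n) t} →
  All (λ g → lin a g ≡ 0ℤ) G → lin a (lincomb ks G) ≡ 0ℤ
lin-lincomb-0 a []       All.[] = lin-0ᵥ a
lin-lincomb-0 a (k ∷ ks) {g ∷ G} (ag≡0 All.∷ aG≡0) = begin
  lin a (k *ᵥ g +ᵥ lincomb ks G)           ≡⟨ lin-+ᵥ a (k *ᵥ g) (lincomb ks G) ⟩
  lin a (k *ᵥ g) ℤ.+ lin a (lincomb ks G)  ≡⟨ cong₂ ℤ._+_ (lin-*ᵥ a k g) (lin-lincomb-0 a ks aG≡0) ⟩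
  + k ℤ.* lin a g ℤ.+ 0ℤ                   ≡⟨ cong (λ u → + k ℤ.* u ℤ.+ 0ℤ) ag≡0 ⟩
  + k ℤ.* 0ℤ ℤ.+ 0ℤ                        ≡⟨ cong (ℤ._+ 0ℤ) (ℤP.*-zeroʳ (+ k)) ⟩
  0ℤ                                       ∎
  where open ≡-Reasoning

solutions-lincomb : ∀ {m n t} (A : Vec (Vec ℤ n) m) (ks : Vec ℕ t) {G : Vec (Vec ℕ n) t} →
  All (Solutions A) G → Solutions A (lincomb ks G)
solutions-lincomb []      ks sols = All.[]
solutions-lincomb (a ∷ A) ks sols =
  lin-lincomb-0 a ks (All.map All.head sols) All.∷ solutions-lincomb A ks (All.map All.tail sols)

-- ℕⁿ is the solution set of the equation 0·x = 0. Adding an equation a·x = 0 to a system whose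
-- solutions are generated by G leaves the single equation (a·G)·ks = 0 on coefficient vectors.
gordan : ∀ {m n} (A : Vec (Vec ℤ n) m) → FinitelyGenerated (Solutions A)
gordan {n = n} [] = record
  { size       = size
  ; generators = generators
  ; sound      = All.universal (λ _ → All.[]) generators
  ; complete   = λ {x} _ → complete (lin-zeroˡ x)
  }
  where open FinitelyGenerated (equation-finitelyGenerated (V.replicate n 0ℤ))
gordan (a ∷ A) = record
  { size       = H.size
  ; generators = V.map (λ h → lincomb h G.generators) H.generators
  ; sound      = AllP.map⁺ (All.map (λ {h} ch≡0 → trans (lin-lincomb a h G.generators) ch≡0
                                          All.∷ solutions-lincomb A h G.sound) H.sound)
  ; complete   = decompose
  }
  where
  module G = FinitelyGenerated (gordan A)
  module H = FinitelyGenerated (equation-finitelyGenerated (V.map (lin a) G.generators))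
  decompose : ∀ {x} → Solutions (a ∷ A) x → x ∈⟨ V.map (λ h → lincomb h G.generators) H.generators ⟩
  decompose {x} (ax≡0 All.∷ Ax≡0) with G.complete Ax≡0
  ... | ks , x≡ with H.complete (trans (sym (lin-lincomb a ks G.generators)) (trans (cong (lin a) (sym x≡)) ax≡0))
  ... | ks′ , ks≡ = ks′ , (begin
    x                                                      ≡⟨ x≡ ⟩
    lincomb ks G.generators                                ≡⟨ cong (λ z → lincomb z G.generators) ks≡ ⟩
    lincomb (lincomb ks′ H.generators) G.generators        ≡⟨ lincomb-lincomb ks′ H.generators G.generators ⟩
    lincomb ks′ (V.map (λ h → lincomb h G.generators) H.generators) ∎)
    where open ≡-Reasoning

lin-++ : ∀ {p q} (a : Vec ℤ p) (b : Vec ℤ q) x y → lin (a V.++ b) (x V.++ y) ≡ lin a x ℤ.+ lin b y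
lin-++ []       b []       y = sym (ℤP.+-identityˡ (lin b y))
lin-++ (a ∷ as) b (x ∷ xs) y =
  trans (cong (λ z → a ℤ.* + x ℤ.+ z) (lin-++ as b xs y)) (sym (ℤP.+-assoc (a ℤ.* + x) (lin as xs) (lin b y)))

lin-neg : ∀ {p} (a : Vec ℤ p) x → lin (V.map ℤ.-_ a) x ≡ ℤ.- lin a x
lin-neg []       []       = refl
lin-neg (a ∷ as) (x ∷ xs) = begin
  ℤ.- a ℤ.* + x ℤ.+ lin (V.map ℤ.-_ as) xs   ≡⟨ cong₂ ℤ._+_ (sym (ℤP.neg-distribˡ-* a (+ x))) (lin-neg as xs) ⟩
  ℤ.- (a ℤ.* + x) ℤ.+ ℤ.- lin as xs          ≡⟨ ℤP.neg-distrib-+ (a ℤ.* + x) (lin as xs) ⟨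
  ℤ.- (a ℤ.* + x ℤ.+ lin as xs)              ∎
  where open ≡-Reasoning

pairSystem : ∀ {m d} → Matrix m d → Vec (Vec ℤ (d ℕ.+ d)) m
pairSystem = V.map (λ a → a V.++ V.map ℤ.-_ a)

lin-pairSystem : ∀ {d} (a : Vec ℤ d) u v → lin (a V.++ V.map ℤ.-_ a) (u V.++ v) ≡ lin a u ℤ.- lin a v
lin-pairSystem a u v = trans (lin-++ a (V.map ℤ.-_ a) u v) (cong (λ z → lin a u ℤ.+ z) (lin-neg a v))

sameImage⇒pairSolution : ∀ {m d} (A : Matrix m d) u v → A · ι u ≡ A · ι v → Solutions (pairSystem A) (u V.++ v)
sameImage⇒pairSolution []      u v eq = All.[]
sameImage⇒pairSolution (a ∷ A) u v eq =
  trans (lin-pairSystem a u v) (ℤP.i≡j⇒i-j≡0 (VP.∷-injectiveˡ eq)) All.∷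
  sameImage⇒pairSolution A u v (VP.∷-injectiveʳ eq)

pairSolution⇒sameImage : ∀ {m d} (A : Matrix m d) u v → Solutions (pairSystem A) (u V.++ v) → A · ι u ≡ A · ι v
pairSolution⇒sameImage []      u v sol = refl
pairSolution⇒sameImage (a ∷ A) u v (s All.∷ sol) =
  cong₂ _∷_ (ℤP.i-j≡0⇒i≡j _ _ (trans (sym (lin-pairSystem a u v)) s)) (pairSolution⇒sameImage A u v sol)

0ᵥ-++ : ∀ p q → 0ᵥ {p ℕ.+ q} ≡ 0ᵥ {p} V.++ 0ᵥ {q}
0ᵥ-++ zero    q = refl
0ᵥ-++ (suc p) q = cong (0 ∷_) (0ᵥ-++ p q)

lincomb-++ : ∀ {p q t} (ks : Vec ℕ t) (G : Vec (Vec ℕ (p ℕ.+ q)) t) →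
  lincomb ks G ≡ lincomb ks (V.map (V.take p) G) V.++ lincomb ks (V.map (V.drop p) G)
lincomb-++ {p} {q} []       []      = 0ᵥ-++ p q
lincomb-++ {p}     (k ∷ ks) (g ∷ G) = begin
  k *ᵥ g +ᵥ lincomb ks G
    ≡⟨ cong₂ (λ x y → k *ᵥ x +ᵥ y) (sym (VP.take++drop≡id p g)) (lincomb-++ ks G) ⟩
  k *ᵥ (V.take p g V.++ V.drop p g) +ᵥ (S V.++ T)
    ≡⟨ cong (_+ᵥ (S V.++ T)) (VP.map-++ (k ℕ.*_) (V.take p g) (V.drop p g)) ⟩
  (k *ᵥ V.take p g V.++ k *ᵥ V.drop p g) +ᵥ (S V.++ T)
    ≡⟨ VP.zipWith-++ ℕ._+_ (k *ᵥ V.take p g) (k *ᵥ V.drop p g) S T ⟩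
  (k *ᵥ V.take p g +ᵥ S) V.++ (k *ᵥ V.drop p g +ᵥ T) ∎
  where
  open ≡-Reasoning
  S = lincomb ks (V.map (V.take p) G)
  T = lincomb ks (V.map (V.drop p) G)

-- Compressed walks

walk-map : ∀ {d} {F F′ : Vec ℕ d → Set} {R R′ : Vec ℕ d → Vec ℕ d → Set} (f : Vec ℕ d → Vec ℕ d) →
  (∀ {x} → F x → F′ (f x)) → (∀ {x y} → R x y → R′ (f x) (f y)) →
  ∀ {n u v} → Walk F R n u v → Walk F′ R′ n (f u) (f v)
walk-map f mapF mapR (here u∈F)       = here (mapF u∈F)
walk-map f mapF mapR (step u∈F uRw W) = step (mapF u∈F) (mapR uRw) (walk-map f mapF mapR W)

walk-++ : ∀ {d} {F : Vec ℕ d → Set} {R} {n n′ u w v} → Walk F R n u w → Walk F R n′ w v → Walk F R (n ℕ.+ n′) u v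
walk-++ (here _)          W′ = W′
walk-++ (step u∈F uRw W) W′ = step u∈F uRw (walk-++ W W′)

walk-end : ∀ {d} {F : Vec ℕ d → Set} {R} {n u v} → Walk F R n u v → F v
walk-end (here v∈F)     = v∈F
walk-end (step _ _ W)   = walk-end W

translate-fiber : ∀ {m d} (A : Matrix m d) {x s} → A · ι x ≡ A · ι s →
  ∀ y k → A · ι (y +ᵥ k *ᵥ x) ≡ A · ι (y +ᵥ k *ᵥ s)
translate-fiber []      eq y k = refl
translate-fiber (a ∷ A) {x} {s} eq y k = cong₂ _∷_ row (translate-fiber A (VP.∷-injectiveʳ eq) y k)
  where
  open ≡-Reasoning
  row : lin a (y +ᵥ k *ᵥ x) ≡ lin a (y +ᵥ k *ᵥ s)
  row = begin
    lin a (y +ᵥ k *ᵥ x)          ≡⟨ lin-+ᵥ a y (k *ᵥ x) ⟩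
    lin a y ℤ.+ lin a (k *ᵥ x)   ≡⟨ cong (λ z → lin a y ℤ.+ z) (lin-*ᵥ a k x) ⟩
    lin a y ℤ.+ + k ℤ.* lin a x  ≡⟨ cong (λ z → lin a y ℤ.+ + k ℤ.* z) (VP.∷-injectiveˡ eq) ⟩
    lin a y ℤ.+ + k ℤ.* lin a s  ≡⟨ cong (λ z → lin a y ℤ.+ z) (lin-*ᵥ a k s) ⟨
    lin a y ℤ.+ lin a (k *ᵥ s)   ≡⟨ lin-+ᵥ a y (k *ᵥ s) ⟨
    lin a (y +ᵥ k *ᵥ s)          ∎

diff-translate : ∀ {d} (y : Vec ℕ d) k p q → diff (y +ᵥ k *ᵥ p) (y +ᵥ k *ᵥ q) ≡ scale (+ k) (diff p q)
diff-translate []       k []       []       = refl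
diff-translate (y ∷ ys) k (p ∷ ps) (q ∷ qs) = cong₂ _∷_ entry (diff-translate ys k ps qs)
  where
  embed : ∀ z → + (y ℕ.+ k ℕ.* z) ≡ + y ℤ.+ + k ℤ.* + z
  embed z = trans (ℤP.pos-+ y (k ℕ.* z)) (cong (λ w → + y ℤ.+ w) (ℤP.pos-* k z))
  factor : ∀ y k p q → (y ℤ.+ k ℤ.* p) ℤ.- (y ℤ.+ k ℤ.* q) ≡ k ℤ.* (p ℤ.- q)
  factor = solve-∀
  entry : + (y ℕ.+ k ℕ.* p) ℤ.- + (y ℕ.+ k ℕ.* q) ≡ + k ℤ.* (+ p ℤ.- + q)
  entry = trans (cong₂ ℤ._-_ (embed p) (embed q)) (factor (+ y) (+ k) (+ p) (+ q))

-- Every step of the scaled walk is k·m with m ∈ M.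
translate-walk : ∀ {m d} {A : Matrix m d} {M : List (Vec ℤ d)} {b n s t} →
  Walk (InFiber A (A · ι s)) (Adj M) n s t → ∀ y k → InFiber A b (y +ᵥ k *ᵥ s) →
  Walk (InFiber A b) (AdjC M) n (y +ᵥ k *ᵥ s) (y +ᵥ k *ᵥ t)
translate-walk {A = A} W y k start∈F = walk-map (λ x → y +ᵥ k *ᵥ x) inFiber adjacent W
  where
  inFiber : ∀ {x} → InFiber A _ x → InFiber A _ (y +ᵥ k *ᵥ x)
  inFiber x∈F = trans (translate-fiber A x∈F y k) start∈F
  adjacent : ∀ {x x′} → Adj _ x x′ → AdjC _ (y +ᵥ k *ᵥ x) (y +ᵥ k *ᵥ x′)
  adjacent (inj₁ m∈M) = inj₁ (+ k , _ , m∈M , diff-translate y k _ _)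
  adjacent (inj₂ m∈M) = inj₂ (+ k , _ , m∈M , diff-translate y k _ _)

module _ {m d : ℕ} (A : Matrix m d) (M : List (Vec ℤ d)) where

  MarkovPath : Vec ℕ (d ℕ.+ d) → Set
  MarkovPath g = ∃[ n ] Walk (InFiber A (A · ι (V.take d g))) (Adj M) n (V.take d g) (V.drop d g)

  pairSolution⇒markovPath : MarkovBasis A M → ∀ {g} → Solutions (pairSystem A) g → MarkovPath g
  pairSolution⇒markovPath markov {g} sol =
    markov (A · ι s) (s , refl) s t refl (sym (pairSolution⇒sameImage A s t sol′))
    where
    s = V.take d g
    t = V.drop d g
    sol′ : Solutions (pairSystem A) (s V.++ t)
    sol′ = subst (Solutions (pairSystem A)) (sym (VP.take++drop≡id d g)) sol

  totalLength : ∀ {t} {G : Vec (Vec ℕ (d ℕ.+ d)) t} → All MarkovPath G → ℕ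
  totalLength All.[]              = 0
  totalLength ((n , _) All.∷ ps) = n ℕ.+ totalLength ps

  -- Trade the sources for the targets one generator g at a time, along the path of g scaled by
  -- its coefficient.
  compressed-walk : ∀ {t b} {G : Vec (Vec ℕ (d ℕ.+ d)) t} (paths : All MarkovPath G) ks y →
    InFiber A b (y +ᵥ lincomb ks (V.map (V.take d) G)) →
    ∃[ n ] (n ≤ totalLength paths × Walk (InFiber A b) (AdjC M) n
      (y +ᵥ lincomb ks (V.map (V.take d) G)) (y +ᵥ lincomb ks (V.map (V.drop d) G)))
  compressed-walk All.[] [] y start∈F = 0 , z≤n , here start∈F
  compressed-walk {b = b} {G = g ∷ G} ((n , W) All.∷ paths) (k ∷ ks) y start∈F =
    let n′ , n′≤ , W₂ = compressed-walk paths ks (y +ᵥ k *ᵥ t) (subst (InFiber A b) reorder₂ (walk-end W₁))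
    in n ℕ.+ n′ , ℕP.+-monoʳ-≤ n n′≤ ,
       walk-++ (subst₂ (Walk (InFiber A b) (AdjC M) n) (sym reorder₁) reorder₂ W₁)
               (subst (Walk (InFiber A b) (AdjC M) n′ _) (+ᵥ-assoc y (k *ᵥ t) T) W₂)
    where
    s = V.take d g
    t = V.drop d g
    S = lincomb ks (V.map (V.take d) G)
    T = lincomb ks (V.map (V.drop d) G)
    reorder₁ : y +ᵥ (k *ᵥ s +ᵥ S) ≡ (y +ᵥ S) +ᵥ k *ᵥ s
    reorder₁ = +ᵥ.x∙yz≈xz∙y y (k *ᵥ s) S
    reorder₂ : (y +ᵥ S) +ᵥ k *ᵥ t ≡ (y +ᵥ k *ᵥ t) +ᵥ S
    reorder₂ = +ᵥ.xy∙z≈xz∙y y S (k *ᵥ t)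
    W₁ = translate-walk W (y +ᵥ S) k (subst (InFiber A b) reorder₁ start∈F)

  ∈⟨⟩⇒walk : ∀ {t b} {G : Vec (Vec ℕ (d ℕ.+ d)) t} (paths : All MarkovPath G) {u v} →
    u V.++ v ∈⟨ G ⟩ → InFiber A b u → ∃[ n ] (n ≤ totalLength paths × Walk (InFiber A b) (AdjC M) n u v)
  ∈⟨⟩⇒walk {b = b} {G} paths {u} {v} (ks , uv≡) u∈F =
    let n , n≤ , W = compressed-walk paths ks 0ᵥ (subst (InFiber A b) u≡ u∈F)
    in n , n≤ , subst₂ (Walk (InFiber A b) (AdjC M) n) (sym u≡) (sym v≡) W
    where
    split = trans uv≡ (lincomb-++ ks G)
    u≡ : u ≡ 0ᵥ +ᵥ lincomb ks (V.map (V.take d) G)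
    u≡ = trans (VP.++-injectiveˡ u _ split) (sym (+ᵥ-identityˡ _))
    v≡ : v ≡ 0ᵥ +ᵥ lincomb ks (V.map (V.drop d) G)
    v≡ = trans (VP.++-injectiveʳ u _ split) (sym (+ᵥ-identityˡ _))

theorem3p15 : (m d : ℕ) (A : Matrix m d) (M : List (Vec ℤ d))
    → KerPositiveTrivial A
    → MarkovBasis A M
    → ∃[ C ] ((b : Vec ℤ m) → InSemigroup A b → DiamLe (InFiber A b) (AdjC M) C)
theorem3p15 m d A M _ markov = totalLength A M paths , λ b _ u v u∈F v∈F →
  ∈⟨⟩⇒walk A M paths (complete (sameImage⇒pairSolution A u v (trans u∈F (sym v∈F)))) u∈F
  where
  open FinitelyGenerated (gordan (pairSystem A))
  paths : All (MarkovPath A M) generators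
  paths = All.map (pairSolution⇒markovPath A M markov) sound
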